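{- Let $\lambda$ be a Dyck path of order $n$ and $L$ a natural labeling of $P_\lambda$; for $i\in[n]$ let $\ell_i$ and $r_i$ be the positions of the up step and the down step of the chord with label $i$. Then $\operatorname{INV}(\ell)\subseteq\operatorname{INV}(r)$, where $\ell=\ell_1\cdots\ell_n$ and $r=r_1\cdots r_n$. In particular, if $\sigma$ and $\tau$ are the standardizations of $\ell$ and $r$, then $\operatorname{INV}(\sigma)\subseteq\operatorname{INV}(\tau)$.
   Context: For a word $w=w_1\cdots w_n$, $\operatorname{INV}(w)=\{(i,j):i<j,\ w_j<w_i\}$. The standardization of a word of distinct integers $w$ is the permutation $\pi\in S_n$ with $\pi_i<\pi_j$ iff $w_i<w_j$. A Dyck path of order $n$ is a sequence of $2n$ steps U (up) and D (down), numbered $1,\dots,2n$, whose partial sums (U$=+1$, D$=-1$) are nonnegative and total $0$. Each up step is matched with a down step as in balanced parentheses; such a pair is a chord. The chord poset $P_\lambda$: $c<c'$ iff both steps of $c'$ lie strictly between those of $c$. A natural labeling is a bijection $L:P_\lambda\to[n]$ with $L(c)<L(c')$ whenever $c<c'$. -}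

module Defs where

open import Data.Nat using (ℕ; zero; suc; _<_; _≤_; _∸_; _*_)
open import Data.Integer using (ℤ; +_; _+_; -[1+_]) renaming (_≤_ to _≤ℤ_; _<_ to _<ℤ_)
open import Data.List using (List; []; _∷_; length; take)
open import Data.Maybe using (Maybe; just; nothing)
open import Data.Fin using (Fin; toℕ)
open import Data.Fin.Permutation using (Permutation′; _⟨$⟩ʳ_)
open import Data.Product using (Σ; ∃; _×_; _,_)
open import Relation.Binary.PropositionalEquality using (_≡_)
open import Function.Bundles using (_⇔_)

data Step : Set where
  U D : Step

stepValue : Step → ℤ
stepValue U = + 1
stepValue D = -[1+ 0 ]

heightL : List Step → ℤ
heightL [] = + 0
heightL (s ∷ w) = stepValue s + heightL w

height : List Step → ℕ → ℤ
height w k = heightL (take k w)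

-- the step at (1-based) position p
_at_ : List Step → ℕ → Maybe Step
[] at p = nothing
(s ∷ w) at zero = nothing
(s ∷ w) at suc zero = just s
(s ∷ w) at suc (suc p) = w at suc p

IsDyck : ℕ → List Step → Set
IsDyck n w = length w ≡ 2 * n
           × (∀ k → k ≤ 2 * n → + 0 ≤ℤ height w k)
           × height w (2 * n) ≡ + 0

-- the up step at position a is matched (balanced-parentheses) with the down step at b
Matched : List Step → ℕ → ℕ → Set
Matched w a b = 1 ≤ a × a < b × b ≤ length w
              × w at a ≡ just U × w at b ≡ just D
              × height w b ≡ height w (a ∸ 1)
              × (∀ k → a ≤ k → k < b → height w (a ∸ 1) <ℤ height w k)

-- A natural labeling L of the chord poset of w, given through its inverse:
-- label i ∈ [n] (here Fin n) is the chord with up step ℓ i and down step r i.  Naturality: c < c' (c' strictly nested in c) ⇒ L c < L c'.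
record NaturalLabeling (n : ℕ) (w : List Step) : Set where
  field
    ℓ r : Fin n → ℕ
    isChord : ∀ i → Matched w (ℓ i) (r i)
    injective : ∀ i j → ℓ i ≡ ℓ j → r i ≡ r j → i ≡ j
    surjective : ∀ a b → Matched w a b → ∃ λ i → ℓ i ≡ a × r i ≡ b
    natural : ∀ i j → ℓ i < ℓ j → r j < r i → toℕ i < toℕ j

INV : ∀ {n} → (Fin n → ℕ) → Fin n → Fin n → Set
INV w i j = toℕ i < toℕ j × w j < w i

IsStandardization : ∀ {n} → (Fin n → ℕ) → Permutation′ n → Set
IsStandardization {n} w σ = ∀ i j → (toℕ (σ ⟨$⟩ʳ i) < toℕ (σ ⟨$⟩ʳ j)) ⇔ (w i < w j)

-- word of a permutation, as naturals (values 0..n-1; shifting by 1 does not change INV)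
permWord : ∀ {n} → Permutation′ n → Fin n → ℕ
permWord σ i = toℕ (σ ⟨$⟩ʳ i)

-- If ℓ j < ℓ i for labels i < j, chord j cannot be nested in chord i, since naturality
-- would give j < i; and two chords never share a down step. So the chords cross, r j < r i.
module Submission where

open import Defs
open import Data.Nat using (ℕ; _<_; s≤s⁻¹; s≤s; z≤n)
open import Data.Nat.Properties using (<-cmp; <-asym; <-irrefl; <-trans; n<1+n)
open import Data.Integer.Properties using () renaming (<-irrefl to <ℤ-irrefl)
open import Data.List using (List)
open import Data.Fin using (Fin)
open import Data.Fin.Permutation using (Permutation′)
open import Data.Product using (_×_; _,_; map₂)
open import Data.Empty using (⊥; ⊥-elim)
open import Function using (_∘_)
open import Function.Bundles using (_⇔_; mk⇔; Equivalence)
open import Relation.Binary using (tri<; tri≈; tri>)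
open import Relation.Binary.PropositionalEquality using (_≡_; sym; trans; subst)

-- The up step at a′ lies strictly inside the chord (a, b), so the height just before it
-- exceeds height w (a ∸ 1) = height w b; yet it equals height w b.
Matched-nested-up-absurd : ∀ {w a a′ b} → Matched w a b → Matched w a′ b → a < a′ → ⊥
Matched-nested-up-absurd
  (_ , _ , _ , _ , _ , returns , stays-above) (s≤s z≤n , a′<b , _ , _ , _ , returns′ , _) a<a′ =
  <ℤ-irrefl (trans (sym returns) returns′)
    (stays-above _ (s≤s⁻¹ a<a′) (<-trans (n<1+n _) a′<b))

Matched-up-unique : ∀ {w a a′ b} → Matched w a b → Matched w a′ b → a ≡ a′
Matched-up-unique {a = a} {a′} m m′ with <-cmp a a′
... | tri< a<a′ _ _ = ⊥-elim (Matched-nested-up-absurd m m′ a<a′)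
... | tri≈ _ a≡a′ _ = a≡a′
... | tri> _ _ a′<a = ⊥-elim (Matched-nested-up-absurd m′ m a′<a)

module _ {n : ℕ} {w : List Step} (L : NaturalLabeling n w) where
  open NaturalLabeling L

  INV-ℓ⊆INV-r : ∀ i j → INV ℓ i j → INV r i j
  INV-ℓ⊆INV-r i j (i<j , ℓj<ℓi) with <-cmp (r j) (r i)
  ... | tri< rj<ri _ _ = i<j , rj<ri
  ... | tri≈ _ rj≡ri _ =
    ⊥-elim (<-irrefl (Matched-up-unique (isChord j) chord-i-ending-at-rj) ℓj<ℓi)
    where chord-i-ending-at-rj = subst (Matched w (ℓ i)) (sym rj≡ri) (isChord i)
  ... | tri> _ _ ri<rj = ⊥-elim (<-asym i<j (natural j i ℓj<ℓi ri<rj))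

INV-standardization : ∀ {n} {u : Fin n → ℕ} {σ : Permutation′ n} → IsStandardization u σ →
  ∀ i j → INV u i j ⇔ INV (permWord σ) i j
INV-standardization std i j =
  mk⇔ (map₂ (Equivalence.from (std j i))) (map₂ (Equivalence.to (std j i)))

lemma3 : (n : ℕ) (w : List Step) → IsDyck n w → (L : NaturalLabeling n w) →
    (∀ i j → INV (NaturalLabeling.ℓ L) i j → INV (NaturalLabeling.r L) i j)
    × ((σ τ : Permutation′ n) → IsStandardization (NaturalLabeling.ℓ L) σ →
        IsStandardization (NaturalLabeling.r L) τ →
        ∀ i j → INV (permWord σ) i j → INV (permWord τ) i j)
lemma3 n w _ L = INV-ℓ⊆INV-r L , λ σ τ stdσ stdτ i j →
  Equivalence.to (INV-standardization {σ = τ} stdτ i j)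
    ∘ INV-ℓ⊆INV-r L i j
    ∘ Equivalence.from (INV-standardization {σ = σ} stdσ i j)
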